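{- Let $G$ be a connected block graph, let $v\in V(G)$, and let $k$ be an integer with $1\le k\le n(G)$. If $T_1$ is a Steiner $k$-ecc $v$-tree in $T(v,G)$, then $T_1$ is also a Steiner $k$-ecc $v$-tree in $G$.
   Context: All graphs are finite, simple and undirected; $n(H)$ and $m(H)$ denote the number of vertices and edges of a graph $H$. A block graph is a graph in which every block is a clique. For $v\in V(G)$ and a block $B$ of $G$, ${\rm Near}_G(v,B)$ is the (unique) vertex of $B$ nearest to $v$ in $G$. The graph $T(v,G)$ is obtained from $G$ by removing, for every block $B$ of $G$, every edge of $B$ not incident with ${\rm Near}_G(v,B)$; it is a spanning tree of $G$. For a graph $H$ and $S\subseteq V(H)$, a Steiner $S$-tree is a connected subgraph of $H$ containing all vertices of $S$ with minimum number of edges. The Steiner $k$-eccentricity of $v$ in $H$ is ${\rm ecc}_k(v,H)=\max\{m(T): T \text{ is a Steiner } S\text{ -tree in } H,\ S\subseteq V(H),\ |S|=k,\ v\in S\}$. A Steiner $k$-ecc $v$-tree in $H$ is a Steiner $S$-tree $T$ in $H$ with $|S|=k$, $v\in S$ and $m(T)={\rm ecc}_k(v,H)$. -}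

module Defs where

open import Data.Nat using (ℕ; zero; suc; _≤_)
open import Data.Fin using (Fin) renaming (_<_ to _<ᶠ_)
open import Data.Bool using (Bool; true; false; T)
open import Data.Unit using (⊤)
open import Data.Product using (Σ; ∃; _×_; _,_; proj₁; proj₂)
open import Data.Sum using (_⊎_)
open import Data.List using (List; length)
open import Data.List.Membership.Propositional using (_∈_)
open import Data.List.Relation.Unary.Unique.Propositional using (Unique)
open import Data.List.Relation.Unary.All using (All)
open import Relation.Binary.PropositionalEquality using (_≡_; _≢_)

-- A finite simple undirected graph on vertex set Fin n (so n(G) = n).
record Graph (n : ℕ) : Set where
  field
    adj    : Fin n → Fin n → Bool
    sym    : ∀ x y → adj x y ≡ adj y x
    irrefl : ∀ x → adj x x ≡ false
open Graph public

EdgeRel : ℕ → Set₁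
EdgeRel n = Fin n → Fin n → Set

GE : ∀ {n} → Graph n → EdgeRel n
GE G x y = T (adj G x y)

data Walk {n : ℕ} (E : EdgeRel n) (P : Fin n → Set) : Fin n → Fin n → ℕ → Set where
  here : ∀ {x} → P x → Walk E P x x 0
  step : ∀ {x y z l} → P x → E x y → Walk E P y z l → Walk E P x z (suc l)

Connected : ∀ {n} → EdgeRel n → (Fin n → Set) → Set
Connected E P = ∀ x y → P x → P y → ∃ λ l → Walk E P x y l

ConnectedGraph : ∀ {n} → Graph n → Set
ConnectedGraph G = Connected (GE G) (λ _ → ⊤)

VSet : ℕ → Set
VSet n = Fin n → Bool

-- the induced subgraph G[B] is nonempty, connected and has no cut vertex
-- (removing any single vertex leaves it connected)
NonSep : ∀ {n} → Graph n → VSet n → Set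
NonSep G B =
  (∃ λ x → T (B x)) ×
  Connected (GE G) (λ y → T (B y)) ×
  (∀ x → T (B x) → Connected (GE G) (λ y → T (B y) × y ≢ x))

Block : ∀ {n} → Graph n → VSet n → Set
Block G B =
  NonSep G B ×
  (∀ B' → (∀ x → T (B x) → T (B' x)) → NonSep G B' → ∀ x → T (B' x) → T (B x))

BlockGraph : ∀ {n} → Graph n → Set
BlockGraph G = ∀ B → Block G B → ∀ x y → T (B x) → T (B y) → x ≢ y → T (adj G x y)

-- u is the vertex of B nearest to v in G (i.e. u = Near_G(v,B))
IsNear : ∀ {n} → Graph n → Fin n → VSet n → Fin n → Set
IsNear G v B u =
  T (B u) ×
  (∀ w → T (B w) → ∀ l → Walk (GE G) (λ _ → ⊤) v w l →
     ∃ λ l' → l' ≤ l × Walk (GE G) (λ _ → ⊤) v u l')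

-- edge relation of T(v,G): an edge xy of G is kept iff for every block B
-- containing it, it is incident with Near_G(v,B)
TvG : ∀ {n} → Graph n → Fin n → EdgeRel n
TvG G v x y =
  T (adj G x y) ×
  (∀ B → Block G B → T (B x) → T (B y) → IsNear G v B x ⊎ IsNear G v B y)

-- a finite subgraph given by its vertex list and edge list
-- (edges stored as ordered pairs (x , y) with x < y, no repetitions)
record Sub (n : ℕ) : Set where
  field
    vs        : List (Fin n)
    es        : List (Fin n × Fin n)
    vs-unique : Unique vs
    es-unique : Unique es
    es-order  : All (λ e → proj₁ e <ᶠ proj₂ e) es
    es-ends   : All (λ e → proj₁ e ∈ vs × proj₂ e ∈ vs) es
open Sub public

m : ∀ {n} → Sub n → ℕ
m S = length (es S)

SubEdge : ∀ {n} → Sub n → EdgeRel n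
SubEdge S x y = ((x , y) ∈ es S) ⊎ ((y , x) ∈ es S)

SubgraphOf : ∀ {n} → EdgeRel n → Sub n → Set
SubgraphOf E S = All (λ e → E (proj₁ e) (proj₂ e)) (es S)

ConnCover : ∀ {n} → EdgeRel n → List (Fin n) → Sub n → Set
ConnCover E X S =
  SubgraphOf E S × Connected (SubEdge S) (λ x → x ∈ vs S) × All (λ x → x ∈ vs S) X

SteinerTree : ∀ {n} → EdgeRel n → List (Fin n) → Sub n → Set
SteinerTree E X S = ConnCover E X S × (∀ S' → ConnCover E X S' → m S ≤ m S')

-- Steiner k-ecc v-tree in the host E: a Steiner X-tree with |X| = k, v ∈ X,
-- whose size equals ecc_k(v) (the maximum over all such Steiner trees)
SteinerEccTree : ∀ {n} → EdgeRel n → ℕ → Fin n → Sub n → Set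
SteinerEccTree {n} E k v S =
  (Σ (List (Fin n)) λ X → length X ≡ k × Unique X × v ∈ X × SteinerTree E X S) ×
  (∀ X' S' → length X' ≡ k → Unique X' → v ∈ X' → SteinerTree E X' S' → m S' ≤ m S)

-- Every connected cover S of X in G with v ∈ X can be traded for one in T(v,G) with at most as many
-- edges: keep the vertices of S and join each of them other than v to its breadth-first parent u in G.
-- The edge uw lies in T(v,G) because u is the vertex of any block through uw nearest to v. In a block
-- graph every walk from v to w passes through u (a walk avoiding u would close a cycle making w adjacent
-- to a vertex closer to v than u), so u lies in S and the new subgraph is connected. It has one edge per
-- vertex of S other than v, as does a breadth-first tree of S, which is a subgraph of S. As T(v,G) ⊆ G,
-- the least size of a cover of any X ∋ v is therefore the same in G and in T(v,G), which transfers both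
-- the minimality of T₁ and the maximality of its size.

module Submission where

open import Defs
open import Data.Nat using (ℕ; zero; suc; _+_; _∸_; _≤_; _<_; z≤n; s≤s; s≤s⁻¹; _≤?_)
open import Data.Nat.Properties
  using (≤-refl; ≤-trans; <-asym; <-trans; <⇒≤; ≮⇒≥; ≰⇒>; ≤⇒≯; n≮n; n<1+n; m≤m+n; +-suc; ∸-monoʳ-<;
         module ≤-Reasoning)
open import Data.Nat.Induction using (<-rec; <-wellFounded)
open import Data.Fin using (Fin) renaming (_<_ to _<ᶠ_)
open import Data.Fin.Properties using (_≟_)
  renaming (_≤?_ to _≤ᶠ?_; ≤-antisym to ≤ᶠ-antisym; ≤-total to ≤ᶠ-total; ≤∧≢⇒< to ≤∧≢⇒<ᶠ)
open import Data.Fin.Subset using (Subset; ∣_∣; _⊂_) renaming (_∈_ to _∈ₛ_)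
open import Data.Fin.Subset.Properties using (p⊂q⇒∣p∣<∣q∣; ∣p∣≤n)
open import Data.Bool using (T)
open import Data.Bool.Properties using (T-≡)
open import Data.Vec using (tabulate)
open import Data.Vec.Properties using (lookup⇒[]=; []=⇒lookup; lookup∘tabulate)
open import Data.Unit using (tt)
open import Data.Empty using (⊥; ⊥-elim)
open import Data.Product using (Σ; ∃; ∃₂; _×_; _,_; proj₁; proj₂; swap)
open import Data.Product.Properties using (,-injective)
open import Data.Sum using (_⊎_; inj₁; inj₂)
import Data.Sum as Sum
open import Data.List using (List; []; _∷_; _++_; _∷ʳ_; length; map; filter)
open import Data.List.Properties using (length-map; length-++-sucʳ; ++-assoc)
open import Data.List.Membership.Propositional using (_∈_)
open import Data.List.Membership.Propositional.Properties
  using (∈-++⁺ˡ; ∈-++⁺ʳ; ∈-++⁻; ∈-∃++; ∈-filter⁻; ∈-map∘filter⁺; ∈-map∘filter⁻)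
open import Data.List.Relation.Unary.Any using (here; there; any?)
open import Data.List.Relation.Unary.All as All using (All; []; _∷_)
open import Data.List.Relation.Unary.All.Properties using (¬Any⇒All¬; map⁺)
open import Data.List.Relation.Unary.AllPairs using ([]; _∷_)
open import Data.List.Relation.Unary.Unique.Propositional using (Unique)
open import Data.List.Relation.Unary.Unique.Propositional.Properties using (++⁺; filter⁺)
open import Data.List.Relation.Binary.Permutation.Propositional
  using (_↭_; ↭-reflexive; ↭-sym; ↭-trans; ↭⇒↭ₛ)
open import Data.List.Relation.Binary.Permutation.Propositional.Properties using (++-comm; ∈-resp-↭)
import Data.List.Relation.Binary.Permutation.Setoid.Properties as PermutationSetoid
open import Effect.Monad using (RawMonad)
open import Function using (_∘_; id; Equivalence)
import Induction.WellFounded as WF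
open import Level using (0ℓ)
import Relation.Binary.Construct.On as On
open import Relation.Binary.PropositionalEquality as ≡ using (_≡_; _≢_; refl; trans; cong; cong₂; subst)
open import Relation.Nullary using (¬_; Dec; yes; no; ¬?)
open import Relation.Nullary.Decidable using (isYes; toWitness; fromWitness; T?; decidable-stable; ¬¬-excluded-middle)
open import Relation.Nullary.Negation using (¬¬-Monad; contradiction)
open import Relation.Unary using (U; _∩_; ∁)

-- The arguments are classical and run in the double-negation monad; every conclusion extracted from it
-- (an inequality of naturals, an adjacency) is decidable.
open RawMonad (¬¬-Monad {0ℓ}) using (pure; _>>=_)

private
  variable
    n k l : ℕ
    a b c d u v w x y z : Fin n
    E : EdgeRel n
    P Q : Fin n → Set

Minimal : (ℕ → Set) → ℕ → Set
Minimal P k = P k × (∀ j → P j → k ≤ j)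

¬¬-minimal : {P : ℕ → Set} → P k → ¬ ¬ ∃ (Minimal P)
¬¬-minimal {k} {P} = <-rec (λ k → P k → ¬ ¬ ∃ (Minimal P)) descend k
  where
  descend : ∀ k → (∀ {j} → j < k → P j → ¬ ¬ ∃ (Minimal P)) → P k → ¬ ¬ ∃ (Minimal P)
  descend k rec pk = do
    yes (j , j<k , pj) ← ¬¬-excluded-middle {A = ∃ λ j → j < k × P j}
      where no ∄j → pure (k , pk , λ j pj → ≮⇒≥ λ j<k → ∄j (j , j<k , pj))
    rec j<k pj

¬¬-Π : {P : Fin n → Set} → (∀ i → ¬ ¬ P i) → ¬ ¬ (∀ i → P i)
¬¬-Π {zero} _ = pure λ ()
¬¬-Π {suc n} f = do
  p₀ ← f Fin.zero
  ps ← ¬¬-Π (f ∘ Fin.suc)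
  pure λ { Fin.zero → p₀ ; (Fin.suc i) → ps i }

_∈?_ : (x : Fin n) (xs : List (Fin n)) → Dec (x ∈ xs)
x ∈? xs = any? (x ≟_) xs

module _ {A : Set} where

  Unique-resp-↭ : {xs ys : List A} → xs ↭ ys → Unique xs → Unique ys
  Unique-resp-↭ p = PermutationSetoid.Unique-resp-↭ (≡.setoid A) (↭⇒↭ₛ p)

  Unique-map⁺ : {B : Set} {f : A → B} {xs : List A} → Unique xs →
                (∀ {a b} → a ∈ xs → b ∈ xs → f a ≡ f b → a ≡ b) → Unique (map f xs)
  Unique-map⁺ [] _ = []
  Unique-map⁺ (x∉ ∷ u) inj =
    map⁺ (All.tabulate λ y∈ fx≡fy → All.lookup x∉ y∈ (inj (here refl) (there y∈) fx≡fy))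
    ∷ Unique-map⁺ u (λ a∈ b∈ → inj (there a∈) (there b∈))

  Unique-⊆⇒length≤ : {xs ys : List A} → Unique xs → (∀ {z} → z ∈ xs → z ∈ ys) → length xs ≤ length ys
  Unique-⊆⇒length≤ [] _ = z≤n
  Unique-⊆⇒length≤ {x ∷ xs} (x∉ ∷ u) xs⊆ys with ∈-∃++ (xs⊆ys (here refl))
  ... | ys₁ , ys₂ , refl =
    subst (suc (length xs) ≤_) (≡.sym (length-++-sucʳ ys₁ x ys₂)) (s≤s (Unique-⊆⇒length≤ u xs⊆ys₁ys₂))
    where
    xs⊆ys₁ys₂ : ∀ {z} → z ∈ xs → z ∈ ys₁ ++ ys₂
    xs⊆ys₁ys₂ z∈ with ∈-++⁻ ys₁ (xs⊆ys (there z∈))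
    ... | inj₁ z∈₁ = ∈-++⁺ˡ z∈₁
    ... | inj₂ (here z≡x) = ⊥-elim (All.lookup x∉ z∈ (≡.sym z≡x))
    ... | inj₂ (there z∈₂) = ∈-++⁺ʳ ys₁ z∈₂

-- The orientation (min, max) in which a Sub stores an edge.
ord : Fin n → Fin n → Fin n × Fin n
ord a b with a ≤ᶠ? b
... | yes _ = a , b
... | no _ = b , a

ord-cases : ∀ (a b : Fin n) → ord a b ≡ (a , b) ⊎ ord a b ≡ (b , a)
ord-cases a b with a ≤ᶠ? b
... | yes _ = inj₁ refl
... | no _ = inj₂ refl

ord-elim : (R : Fin n → Fin n → Set) → R a b → R b a → R (proj₁ (ord a b)) (proj₂ (ord a b))
ord-elim {a = a} {b} R rab rba with a ≤ᶠ? b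
... | yes _ = rab
... | no _ = rba

ord-sym : ∀ (a b : Fin n) → ord a b ≡ ord b a
ord-sym a b with a ≤ᶠ? b | b ≤ᶠ? a
... | yes a≤b | yes b≤a rewrite ≤ᶠ-antisym a≤b b≤a = refl
... | yes _ | no _ = refl
... | no _ | yes _ = refl
... | no a≰b | no b≰a = contradiction (≤ᶠ-total a b) (Sum.[ a≰b , b≰a ])

ord-sorted : a <ᶠ b → ord a b ≡ (a , b)
ord-sorted {a = a} {b} a<b with a ≤ᶠ? b
... | yes _ = refl
... | no a≰b = contradiction (<⇒≤ a<b) a≰b

ord-< : a ≢ b → proj₁ (ord a b) <ᶠ proj₂ (ord a b)
ord-< {a = a} {b} a≢b with a ≤ᶠ? b
... | yes a≤b = ≤∧≢⇒<ᶠ a≤b a≢b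
... | no a≰b = ≰⇒> a≰b

ord-injective : ord a b ≡ ord c d → a ≡ c × b ≡ d ⊎ a ≡ d × b ≡ c
ord-injective {a = a} {b} {c} {d} eq with ord-cases a b | ord-cases c d
... | inj₁ p | inj₁ q = inj₁ (,-injective (trans (≡.sym p) (trans eq q)))
... | inj₁ p | inj₂ q = inj₂ (,-injective (trans (≡.sym p) (trans eq q)))
... | inj₂ p | inj₁ q = inj₂ (swap (,-injective (trans (≡.sym p) (trans eq q))))
... | inj₂ p | inj₂ q = inj₁ (swap (,-injective (trans (≡.sym p) (trans eq q))))

ord∈⇒SubEdge : (S : Sub n) → ord a b ∈ es S → SubEdge S a b
ord∈⇒SubEdge {a = a} {b} S e∈ with ord-cases a b
... | inj₁ eq = inj₁ (subst (_∈ es S) eq e∈)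
... | inj₂ eq = inj₂ (subst (_∈ es S) eq e∈)

SubEdge⇒ord∈ : (S : Sub n) → SubEdge S a b → ord a b ∈ es S
SubEdge⇒ord∈ S (inj₁ ab∈) = subst (_∈ es S) (≡.sym (ord-sorted (All.lookup (es-order S) ab∈))) ab∈
SubEdge⇒ord∈ {a = a} {b} S (inj₂ ba∈) =
  subst (_∈ es S) (≡.sym (trans (ord-sym a b) (ord-sorted (All.lookup (es-order S) ba∈)))) ba∈

-- Walks and paths

vertices : Walk {n} E P x y l → List (Fin n)
vertices (here {x} _) = x ∷ []
vertices (step {x} _ _ ω) = x ∷ vertices ω

initVertices : Walk {n} E P x y l → List (Fin n)
initVertices (here _) = []
initVertices (step {x} _ _ ω) = x ∷ initVertices ω

vertices≡initVertices∷ʳ : (ω : Walk E P x y l) → vertices ω ≡ initVertices ω ∷ʳ y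
vertices≡initVertices∷ʳ (here _) = refl
vertices≡initVertices∷ʳ (step _ _ ω) = cong (_ ∷_) (vertices≡initVertices∷ʳ ω)

P-source : Walk E P x y l → P x
P-source (here p) = p
P-source (step p _ _) = p

walk₀⇒≡ : Walk E P x y 0 → x ≡ y
walk₀⇒≡ (here _) = refl

All-vertices : (ω : Walk E P x y l) → All P (vertices ω)
All-vertices (here p) = p ∷ []
All-vertices (step p _ ω) = p ∷ All-vertices ω

source∈vertices : (ω : Walk E P x y l) → x ∈ vertices ω
source∈vertices (here _) = here refl
source∈vertices (step _ _ _) = here refl

mapᴾ : (∀ {z} → P z → Q z) → Walk E P x y l → Walk E Q x y l
mapᴾ f (here p) = here (f p)
mapᴾ f (step p e ω) = step (f p) e (mapᴾ f ω)

initVertices-mapᴾ : (f : ∀ {z} → P z → Q z) (ω : Walk E P x y l) → initVertices (mapᴾ f ω) ≡ initVertices ω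
initVertices-mapᴾ f (here _) = refl
initVertices-mapᴾ f (step _ _ ω) = cong (_ ∷_) (initVertices-mapᴾ f ω)

mapᴱ : ∀ {E E′ : EdgeRel n} → (∀ {a b} → E a b → E′ a b) → Walk E P x y l → Walk E′ P x y l
mapᴱ f (here p) = here p
mapᴱ f (step p e ω) = step p (f e) (mapᴱ f ω)

_++ʷ_ : Walk E P x y k → Walk E P y z l → Walk E P x z (k + l)
here _ ++ʷ ω′ = ω′
step p e ω ++ʷ ω′ = step p e (ω ++ʷ ω′)

initVertices-++ʷ : (ω : Walk E P x y k) (ω′ : Walk E P y z l) →
                   initVertices (ω ++ʷ ω′) ≡ initVertices ω ++ initVertices ω′
initVertices-++ʷ (here _) ω′ = refl
initVertices-++ʷ (step _ _ ω) ω′ = cong (_ ∷_) (initVertices-++ʷ ω ω′)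

snoc : Walk E P x y l → E y z → P z → Walk E P x z (suc l)
snoc (here p) e pz = step p e (here pz)
snoc (step p e ω) e′ pz = step p e (snoc ω e′ pz)

unsnoc : (ω : Walk E P x z (suc l)) →
         ∃ λ y → Σ (Walk E P x y l) λ ω′ → E y z × vertices ω′ ≡ initVertices ω
unsnoc (step p e (here _)) = _ , here p , e , refl
unsnoc (step p e ω@(step _ _ _)) with unsnoc ω
... | y , ω′ , e′ , eq = y , step p e ω′ , e′ , cong (_ ∷_) eq

reverse : (∀ {a b} → E a b → E b a) → Walk E P x y l → Walk E P y x l
reverse sym (here p) = here p
reverse sym (step p e ω) = snoc (reverse sym ω) (sym e) p

prefix : (ω : Walk E P x y l) → (∀ {z} → z ∈ vertices ω → Q z) → a ∈ vertices ω → ∃ (Walk E Q x a)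
prefix (here _) Q⊇ (here refl) = 0 , here (Q⊇ (here refl))
prefix (step _ _ _) Q⊇ (here refl) = 0 , here (Q⊇ (here refl))
prefix (step _ e ω) Q⊇ (there a∈) with prefix ω (Q⊇ ∘ there) a∈
... | k , ω′ = suc k , step (Q⊇ (here refl)) e ω′

connect : (∀ {a b} → E a b → E b a) → (ω : Walk E P x y l) → (∀ {z} → z ∈ vertices ω → Q z) →
          a ∈ vertices ω → b ∈ vertices ω → ∃ (Walk E Q a b)
connect sym ω Q⊇ a∈ b∈ with prefix ω Q⊇ a∈ | prefix ω Q⊇ b∈
... | _ , ω₁ | _ , ω₂ = _ , reverse sym ω₁ ++ʷ ω₂

split : (ω : Walk E P x y l) → z ∈ initVertices ω →
        Σ (∃ (Walk E P x z)) λ (_ , ω₁) → Σ (∃ (Walk E P z y)) λ (_ , ω₂) →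
          initVertices ω ≡ initVertices ω₁ ++ initVertices ω₂
split ω@(step p _ _) (here refl) = (0 , here p) , (_ , ω) , refl
split (step p e ω) (there z∈) with split ω z∈
... | (_ , ω₁) , ω₂ , eq = (_ , step p e ω₁) , ω₂ , cong (_ ∷_) eq

rotate : (C : Walk E P x x l) → c ∈ initVertices C →
         Σ (∃ (Walk E P c c)) λ (_ , C′) → initVertices C′ ↭ initVertices C
rotate C c∈ with split C c∈
... | (_ , ω₁) , (_ , ω₂) , eq =
  (_ , ω₂ ++ʷ ω₁) ,
  ↭-trans (↭-reflexive (initVertices-++ʷ ω₂ ω₁))
          (↭-trans (++-comm (initVertices ω₂) _) (↭-reflexive (≡.sym eq)))

Path : EdgeRel n → (Fin n → Set) → Fin n → Fin n → Set
Path E P x y = ∃₂ λ k (ω : Walk E P x y k) → Unique (vertices ω)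

suffix : (ω : Walk E P x y l) → Unique (vertices ω) → z ∈ vertices ω → Path E P z y
suffix ω@(here _) u (here refl) = _ , ω , u
suffix ω@(step _ _ _) u (here refl) = _ , ω , u
suffix (step _ _ ω) (_ ∷ u) (there z∈) = suffix ω u z∈

path : Walk E P x y l → Path E P x y
path (here p) = _ , here p , [] ∷ []
path (step {x} p e ω) with path ω
... | k , π , uπ with x ∈? vertices π
...   | yes x∈ = suffix π uπ x∈
...   | no x∉ = suc k , step p e π , ¬Any⇒All¬ _ x∉ ∷ uπ

¬¬-lastExit : (L : Fin n → Set) → Walk E P a b l → ¬ L b →
              ¬ ¬ (∃ (Walk E (P ∩ ∁ L) a b) ⊎ ∃₂ λ x y → L x × E x y × ∃ (Walk E (P ∩ ∁ L) y b))
¬¬-lastExit L (here p) ¬Lb = pure (inj₁ (_ , here (p , ¬Lb)))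
¬¬-lastExit L (step {a} p e ω) ¬Lb = do
  inj₁ (_ , ω′) ← ¬¬-lastExit L ω ¬Lb
    where inj₂ exit → pure (inj₂ exit)
  yes La ← ¬¬-excluded-middle {A = L a}
    where no ¬La → pure (inj₁ (_ , step (p , ¬La) e ω′))
  pure (inj₂ (a , _ , La , e , _ , ω′))

Within : EdgeRel n → Fin n → ℕ → Fin n → Set
Within E v d z = ∃ λ k → k ≤ d × Walk E U v z k

within : ∀ {d} → Walk E U v z k → k ≤ d → Walk E (Within E v d) v z k
within {d = d} = within′ (here tt)
  where
  within′ : ∀ {j} → Walk E U v a j → Walk E U a z k → j + k ≤ d → Walk E (Within E v d) a z k
  within′ ρ (here _) j≤d = here (_ , ≤-trans (m≤m+n _ 0) j≤d , ρ)
  within′ ρ (step _ e ω) j+k≤d =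
    step (_ , ≤-trans (m≤m+n _ _) j+k≤d , ρ) e (within′ (snoc ρ e tt) ω (subst (_≤ d) (+-suc _ _) j+k≤d))

-- Breadth-first parents

record Parent (E : EdgeRel n) (P : Fin n → Set) (v u w : Fin n) : Set where
  field
    edge   : E u w
    depth  : ℕ
    walk   : Walk E P v u depth
    deeper : ∀ {l} → Walk E P v w l → depth < l

open Parent

parent-irrefl : ¬ Parent E P v a a
parent-irrefl π = n≮n _ (deeper π (walk π))

parent-asym : Parent E P v a b → ¬ Parent E P v b a
parent-asym πab πba = <-asym (deeper πab (walk πba)) (deeper πba (walk πab))

¬¬-parent : Walk E P v w l → v ≢ w → ¬ ¬ ∃ λ u → Parent E P v u w
¬¬-parent {E = E} {P} {v} {w} ω v≢w = do
  (suc k , ω′ , shortest) ← ¬¬-minimal {P = Walk E P v w} ω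
    where (zero , ω′ , _) → contradiction (walk₀⇒≡ ω′) v≢w
  let u , ρ , u–w , _ = unsnoc ω′
  pure (u , record { edge = u–w ; depth = k ; walk = ρ ; deeper = λ ω″ → shortest _ ω″ })

record ParentMap (E : EdgeRel n) (P : Fin n → Set) (v : Fin n) (ws : List (Fin n)) : Set where
  field
    parent   : Fin n → Fin n
    isParent : ∀ {w} → w ∈ ws → w ≢ v → Parent E P v (parent w) w

open ParentMap

¬¬-parentMap : {ws : List (Fin n)} → (∀ {w} → w ∈ ws → ∃ (Walk E P v w)) → ¬ ¬ ParentMap E P v ws
¬¬-parentMap {n} {E} {P} {v} {ws} reach = do
  choice ← ¬¬-Π parentOf
  pure record { parent = proj₁ ∘ choice ; isParent = λ {w} → proj₂ (choice w) }
  where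
  parentOf : ∀ w → ¬ ¬ ∃ λ u → w ∈ ws → w ≢ v → Parent E P v u w
  parentOf w with w ∈? ws | w ≟ v
  ... | no w∉ | _ = pure (w , λ w∈ _ → contradiction w∈ w∉)
  ... | yes _ | yes w≡v = pure (w , λ _ w≢v → contradiction w≡v w≢v)
  ... | yes w∈ | no w≢v = do
    (u , π) ← ¬¬-parent (proj₂ (reach w∈)) (w≢v ∘ ≡.sym)
    pure (u , λ _ _ → π)

module TreeEdges (v : Fin n) (ws : List (Fin n)) where

  nonRoot? : (w : Fin n) → Dec (w ≢ v)
  nonRoot? w = ¬? (w ≟ v)

  children : List (Fin n)
  children = filter nonRoot? ws

  treeEdges : (Fin n → Fin n) → List (Fin n × Fin n)
  treeEdges p = map (λ w → ord (p w) w) children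

  treeEdges-length : ∀ p q → length (treeEdges p) ≡ length (treeEdges q)
  treeEdges-length p q = trans (length-map _ children) (≡.sym (length-map _ children))

  ∈-treeEdges⁺ : ∀ p → w ∈ ws → w ≢ v → ord (p w) w ∈ treeEdges p
  ∈-treeEdges⁺ p w∈ w≢v = ∈-map∘filter⁺ (λ w → ord (p w) w) nonRoot? (_ , w∈ , refl , w≢v)

  All-treeEdges : ∀ {R : Fin n × Fin n → Set} p → (∀ {w} → w ∈ ws → w ≢ v → R (ord (p w) w)) →
                  All R (treeEdges p)
  All-treeEdges {R} p r = All.tabulate λ e∈ →
    let w , w∈ , e≡ , w≢v = ∈-map∘filter⁻ (λ w → ord (p w) w) nonRoot? e∈
    in subst R (≡.sym e≡) (r w∈ w≢v)

  treeEdges-unique : Unique ws → (π : ParentMap E P v ws) → Unique (treeEdges (parent π))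
  treeEdges-unique {E = E} {P} uws π = Unique-map⁺ (filter⁺ _ uws) injective
    where
    injective : ∀ {a b} → a ∈ children → b ∈ children → ord (parent π a) a ≡ ord (parent π b) b → a ≡ b
    injective {a} {b} a∈ b∈ eq with ∈-filter⁻ nonRoot? a∈ | ∈-filter⁻ nonRoot? b∈ | ord-injective eq
    ... | _ | _ | inj₁ (_ , a≡b) = a≡b
    ... | a∈ws , a≢v | b∈ws , b≢v | inj₂ (pa≡b , a≡pb) =
      ⊥-elim (parent-asym (subst (λ x → Parent E P v x a) pa≡b (isParent π a∈ws a≢v))
                  (subst (λ x → Parent E P v x b) (≡.sym a≡pb) (isParent π b∈ws b≢v)))

-- Cycles and blocks

symᴳ : (G : Graph n) → GE G a b → GE G b a
symᴳ {a = a} {b} G = subst T (sym G a b)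

_⊆ᵛ_ : VSet n → VSet n → Set
Z ⊆ᵛ B = ∀ x → T (Z x) → T (B x)

⟨_⟩ : List (Fin n) → VSet n
⟨ xs ⟩ y = isYes (y ∈? xs)

⟦_⟧ : VSet n → Subset n
⟦ Z ⟧ = tabulate Z

∈⟦⟧⁺ : {Z : VSet n} → T (Z x) → x ∈ₛ ⟦ Z ⟧
∈⟦⟧⁺ {x = x} {Z} t = lookup⇒[]= x ⟦ Z ⟧ (trans (lookup∘tabulate Z x) (Equivalence.to T-≡ t))

∈⟦⟧⁻ : {Z : VSet n} → x ∈ₛ ⟦ Z ⟧ → T (Z x)
∈⟦⟧⁻ {x = x} {Z} x∈ = Equivalence.from T-≡ (trans (≡.sym (lookup∘tabulate Z x)) ([]=⇒lookup x∈))

#outside : VSet n → ℕ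
#outside {n} Z = n ∸ ∣ ⟦ Z ⟧ ∣

#outside-< : {Z B : VSet n} → Z ⊆ᵛ B → T (B y) → ¬ T (Z y) → #outside B < #outside Z
#outside-< {Z = Z} {B} Z⊆B y∈B y∉Z = ∸-monoʳ-< (p⊂q⇒∣p∣<∣q∣ Z⊂B) (∣p∣≤n ⟦ B ⟧)
  where
  Z⊂B : ⟦ Z ⟧ ⊂ ⟦ B ⟧
  Z⊂B = (λ x∈ → ∈⟦⟧⁺ {Z = B} (Z⊆B _ (∈⟦⟧⁻ x∈))) , _ , ∈⟦⟧⁺ {Z = B} y∈B , y∉Z ∘ ∈⟦⟧⁻

source∈initVertices : (ω : Walk E P x y l) → a ∈ initVertices ω → x ∈ initVertices ω
source∈initVertices (here _) ()
source∈initVertices (step _ _ _) _ = here refl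

module Blocks (G : Graph n) where

  ¬¬-block⊇ : ∀ Z → NonSep G Z → ¬ ¬ ∃ λ B → Block G B × Z ⊆ᵛ B
  ¬¬-block⊇ = WF.All.wfRec (On.wellFounded #outside <-wellFounded) 0ℓ _ grow
    where
    Extensible : VSet n → Set
    Extensible Z = ∃ λ B → Z ⊆ᵛ B × NonSep G B × ∃ λ y → T (B y) × ¬ T (Z y)

    maximal : ∀ {Z} → ¬ Extensible Z → ∀ B → Z ⊆ᵛ B → NonSep G B → B ⊆ᵛ Z
    maximal {Z} ∄B B Z⊆B nsB x x∈B =
      decidable-stable (T? (Z x)) λ x∉Z → ∄B (B , Z⊆B , nsB , x , x∈B , x∉Z)

    grow : ∀ Z → (∀ {B} → #outside B < #outside Z → NonSep G B → ¬ ¬ ∃ λ B′ → Block G B′ × B ⊆ᵛ B′) →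
           NonSep G Z → ¬ ¬ ∃ λ B → Block G B × Z ⊆ᵛ B
    grow Z rec nsZ = do
      yes (B , Z⊆B , nsB , y , y∈B , y∉Z) ← ¬¬-excluded-middle {A = Extensible Z}
        where no ∄B → pure (Z , (nsZ , maximal ∄B) , λ _ → id)
      (B′ , blockB′ , B⊆B′) ← rec (#outside-< Z⊆B y∈B y∉Z) nsB
      pure (B′ , blockB′ , λ x → B⊆B′ x ∘ Z⊆B x)

  cycle-nonSep : (C : Walk (GE G) P x x l) → Unique (initVertices C) → a ∈ initVertices C →
                 NonSep G ⟨ initVertices C ⟩
  cycle-nonSep {P = P} {x = x} C uC a∈ = (x , fromWitness x∈C) , connected , connected-without
    where
    x∈C = source∈initVertices C a∈
    cycle = initVertices C

    init⊆ : ∀ {z} → z ∈ cycle → z ∈ vertices C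
    init⊆ z∈ = subst (_ ∈_) (≡.sym (vertices≡initVertices∷ʳ C)) (∈-++⁺ˡ z∈)

    on-cycle : ∀ {z} → z ∈ vertices C → T (⟨ cycle ⟩ z)
    on-cycle z∈ with ∈-++⁻ cycle (subst (_ ∈_) (vertices≡initVertices∷ʳ C) z∈)
    ... | inj₁ z∈′ = fromWitness z∈′
    ... | inj₂ (here refl) = fromWitness x∈C

    connected : Connected (GE G) (T ∘ ⟨ cycle ⟩)
    connected a b a∈ b∈ = connect (symᴳ G) C on-cycle (init⊆ (toWitness a∈)) (init⊆ (toWitness b∈))

    -- Once the cycle is rotated to start at c, its remaining vertices form a walk avoiding c.
    avoiding : ∀ {c c₁ k} (ρ : Walk (GE G) P c₁ c k) → All (c ≢_) (initVertices ρ) →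
               (∀ {z} → z ∈ initVertices ρ → z ∈ cycle) → a ∈ initVertices ρ → b ∈ initVertices ρ →
               ∃ (Walk (GE G) (λ y → T (⟨ cycle ⟩ y) × y ≢ c) a b)
    avoiding (here _) _ _ ()
    avoiding {c = c} ρ@(step _ _ _) c∉ρ ρ⊆C a∈ b∈ with unsnoc ρ
    ... | _ , ω , _ , eq = connect (symᴳ G) ω stays (subst (_ ∈_) (≡.sym eq) a∈) (subst (_ ∈_) (≡.sym eq) b∈)
      where
      stays : ∀ {z} → z ∈ vertices ω → T (⟨ cycle ⟩ z) × z ≢ c
      stays z∈ = let z∈ρ = subst (_ ∈_) eq z∈ in
        fromWitness (ρ⊆C z∈ρ) , λ z≡c → All.lookup c∉ρ z∈ρ (≡.sym z≡c)

    rotated : ∀ {c k} (C′ : Walk (GE G) P c c k) → initVertices C′ ↭ cycle →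
              Connected (GE G) (λ y → T (⟨ cycle ⟩ y) × y ≢ c)
    rotated (here _) C′↭C _ _ (a∈ , _) _ = contradiction (∈-resp-↭ (↭-sym C′↭C) (toWitness a∈)) λ ()
    rotated {c} (step _ _ ρ) C′↭C a b (a∈ , a≢c) (b∈ , b≢c) with Unique-resp-↭ (↭-sym C′↭C) uC
    ... | c∉ρ ∷ _ = avoiding ρ c∉ρ (∈-resp-↭ C′↭C ∘ there) (onρ a∈ a≢c) (onρ b∈ b≢c)
      where
      onρ : ∀ {z} → T (⟨ cycle ⟩ z) → z ≢ c → z ∈ initVertices ρ
      onρ z∈ z≢c with ∈-resp-↭ (↭-sym C′↭C) (toWitness z∈)
      ... | here z≡c = contradiction z≡c z≢c
      ... | there z∈ρ = z∈ρ

    connected-without : ∀ c → T (⟨ cycle ⟩ c) → Connected (GE G) (λ y → T (⟨ cycle ⟩ y) × y ≢ c)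
    connected-without c c∈ = let (_ , C′) , C′↭C = rotate C (toWitness c∈) in rotated C′ C′↭C

module BlockGraphs (G : Graph n) (bg : BlockGraph G) where
  open Blocks G

  cycle-adjacent : (C : Walk (GE G) P x x l) → Unique (initVertices C) →
                   a ∈ initVertices C → b ∈ initVertices C → a ≢ b → GE G a b
  cycle-adjacent {a = a} {b} C uC a∈ b∈ a≢b = decidable-stable (T? (adj G a b)) do
    (B , blockB , C⊆B) ← ¬¬-block⊇ _ (cycle-nonSep C uC a∈)
    pure (bg B blockB a b (C⊆B a (fromWitness a∈)) (C⊆B b (fromWitness b∈)) a≢b)

  -- The paths x ⋯ u and w ⋯ y together with the edges uw and yx form a cycle.
  disjoint-paths-adjacent : (∀ {z} → P z → Q z → ⊥) → Path (GE G) P x u → Path (GE G) Q w y →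
                            GE G u w → GE G y x → GE G x w
  disjoint-paths-adjacent {Q = Q} {x = x} {u = u} {y = y} P∩Q=∅ (_ , π₁ , uπ₁) (_ , π₂ , uπ₂) u–w y–x =
    cycle-adjacent C (subst Unique (≡.sym C≡π₁π₂) (++⁺ uπ₁ uπ₂ disjoint))
      (subst (_ ∈_) (≡.sym C≡π₁π₂) (∈-++⁺ˡ (source∈vertices π₁)))
      (subst (_ ∈_) (≡.sym C≡π₁π₂) (∈-++⁺ʳ (vertices π₁) (source∈vertices π₂)))
      (λ x≡w → P∩Q=∅ (P-source π₁) (subst Q (≡.sym x≡w) (P-source π₂)))
    where
    π₁′ = mapᴾ {Q = U} (λ _ → tt) π₁
    π₂′ = mapᴾ {Q = U} (λ _ → tt) π₂
    yx : Walk (GE G) U y x 1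
    yx = step tt y–x (here tt)
    back = π₂′ ++ʷ yx
    uw-back : Walk (GE G) U u x _
    uw-back = step tt u–w back
    C = π₁′ ++ʷ uw-back
    open ≡.≡-Reasoning
    C≡π₁π₂ : initVertices C ≡ vertices π₁ ++ vertices π₂
    C≡π₁π₂ = begin
      initVertices C
        ≡⟨ initVertices-++ʷ π₁′ uw-back ⟩
      initVertices π₁′ ++ u ∷ initVertices back
        ≡⟨ cong₂ (λ xs ys → xs ++ u ∷ ys) (initVertices-mapᴾ _ π₁)
                 (trans (initVertices-++ʷ π₂′ yx) (cong (_∷ʳ y) (initVertices-mapᴾ _ π₂))) ⟩
      initVertices π₁ ++ u ∷ (initVertices π₂ ∷ʳ y)
        ≡⟨ ≡.sym (++-assoc (initVertices π₁) (u ∷ []) _) ⟩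
      (initVertices π₁ ∷ʳ u) ++ (initVertices π₂ ∷ʳ y)
        ≡⟨ ≡.sym (cong₂ _++_ (vertices≡initVertices∷ʳ π₁) (vertices≡initVertices∷ʳ π₂)) ⟩
      vertices π₁ ++ vertices π₂ ∎
    disjoint : ∀ {z} → ¬ (z ∈ vertices π₁ × z ∈ vertices π₂)
    disjoint (z∈₁ , z∈₂) = P∩Q=∅ (All.lookup (All-vertices π₁) z∈₁) (All.lookup (All-vertices π₂) z∈₂)

  module _ (v : Fin n) where

    -- Otherwise let x be the last vertex of such a walk closer to v than u, and y its successor. The walks
    -- x ⋯ v ⋯ u and w ⋯ y are disjoint, so with the edges uw and yx they close a cycle; hence x and w are
    -- adjacent, and w would be no deeper than u.
    parent-separates : Parent (GE G) U v u w → ¬ Walk (GE G) (_≢ u) v w l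
    parent-separates record { depth = zero ; walk = ρ } Q = P-source Q (walk₀⇒≡ ρ)
    parent-separates {u = u} {w} π@record { edge = u–w ; depth = suc d ; walk = ρ } Q with unsnoc ρ
    ... | _ , ρ′ , r–u , _ = separated id
      where
      Low = Within (GE G) v d

      w∉Low : ¬ Low w
      w∉Low (_ , k≤d , ω) = ≤⇒≯ k≤d (<-trans (n<1+n d) (deeper π ω))

      Low-nonadjacent : Low x → ¬ GE G x w
      Low-nonadjacent (_ , k≤d , ω) x–w = ≤⇒≯ k≤d (s≤s⁻¹ (deeper π (snoc ω x–w tt)))

      via-u : Low x → ∃ (Walk (GE G) (λ z → Low z ⊎ z ≡ u) x u)
      via-u (_ , k≤d , ω) = _ ,
        snoc (mapᴾ inj₁ (reverse (symᴳ G) (within ω k≤d) ++ʷ within ρ′ ≤-refl)) r–u (inj₂ refl)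

      separate : ∀ {z} → Low z ⊎ z ≡ u → z ≢ u × ¬ Low z → ⊥
      separate (inj₁ low) (_ , ¬low) = ¬low low
      separate (inj₂ z≡u) (z≢u , _) = z≢u z≡u

      separated : ¬ ¬ ⊥
      separated = do
        inj₂ (x , y , x-low , x–y , _ , Y) ← ¬¬-lastExit Low Q w∉Low
          where inj₁ (_ , Q′) → pure (proj₂ (P-source Q′) (0 , z≤n , here tt))
        pure (Low-nonadjacent x-low (disjoint-paths-adjacent separate
          (path (proj₂ (via-u x-low))) (path (reverse (symᴳ G) Y)) u–w (symᴳ G x–y)))

    parent-near : ∀ {B} → Parent (GE G) U v u w → Block G B → T (B u) → T (B w) → IsNear G v B u
    parent-near {u = u} {w} {B} π blockB u∈B w∈B = u∈B , closest
      where
      closest : ∀ z → T (B z) → ∀ l → Walk (GE G) U v z l → ∃ λ l′ → l′ ≤ l × Walk (GE G) U v u l′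
      closest z z∈B l ω with z ≟ u | z ≟ w
      ... | yes refl | _ = l , ≤-refl , ω
      ... | no _ | yes refl = depth π , <⇒≤ (deeper π ω) , walk π
      ... | no _ | no z≢w = depth π , s≤s⁻¹ (deeper π (snoc ω (bg B blockB z w z∈B w∈B z≢w) tt)) , walk π

    parent-edge∈TvG : Parent (GE G) U v u w → TvG G v u w × TvG G v w u
    parent-edge∈TvG π =
      (edge π , λ B blockB u∈B w∈B → inj₁ (parent-near π blockB u∈B w∈B)) ,
      (symᴳ G (edge π) , λ B blockB w∈B u∈B → inj₂ (parent-near π blockB u∈B w∈B))

-- Covers and Steiner trees

ConnCover-mono : ∀ {E′ : EdgeRel n} {X S} → (∀ {a b} → E a b → E′ a b) →
                 ConnCover E X S → ConnCover E′ X S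
ConnCover-mono E⊆E′ (S⊆E , connS , X⊆S) = All.map E⊆E′ S⊆E , connS , X⊆S

¬¬-steiner : ∀ {X S} → ConnCover E X S → ¬ ¬ ∃ (SteinerTree E X)
¬¬-steiner {E = E} {X} {S} cS = do
  (_ , (M , cM , refl) , least) ← ¬¬-minimal {P = λ k → ∃ λ M → ConnCover E X M × m M ≡ k} (S , cS , refl)
  pure (M , cM , λ S′ cS′ → least (m S′) (S′ , cS′ , refl))

module BreadthFirstTree (G : Graph n) (conn : ConnectedGraph G) (bg : BlockGraph G) (v : Fin n)
                        {X : List (Fin n)} {S : Sub n} (cS : ConnCover (GE G) X S) (v∈X : v ∈ X)
                        (πG : ParentMap (GE G) U v (vs S)) where
  open BlockGraphs G bg
  open TreeEdges v (vs S)

  ws = vs S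

  S⊆G = proj₁ cS
  connS = proj₁ (proj₂ cS)

  v∈S : v ∈ ws
  v∈S = All.lookup (proj₂ (proj₂ cS)) v∈X

  SubEdge⇒GE : SubEdge S a b → GE G a b
  SubEdge⇒GE (inj₁ ab∈) = All.lookup S⊆G ab∈
  SubEdge⇒GE (inj₂ ba∈) = symᴳ G (All.lookup S⊆G ba∈)

  parent∈S : w ∈ ws → Parent (GE G) U v u w → u ∈ ws
  parent∈S {w = w} {u} w∈ π = decidable-stable (u ∈? ws) λ u∉ →
    parent-separates v π
      (mapᴾ (λ z∈ z≡u → u∉ (subst (_∈ ws) z≡u z∈)) (mapᴱ SubEdge⇒GE (proj₂ (connS v w v∈S w∈))))

  πᴳ : w ∈ ws → w ≢ v → Parent (GE G) U v (parent πG w) w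
  πᴳ = isParent πG

  tree : Sub n
  tree = record
    { vs        = ws
    ; es        = treeEdges (parent πG)
    ; vs-unique = vs-unique S
    ; es-unique = treeEdges-unique (vs-unique S) πG
    ; es-order  = All-treeEdges _ λ w∈ w≢v →
        ord-< λ p≡w → parent-irrefl (subst (λ x → Parent _ _ v x _) p≡w (πᴳ w∈ w≢v))
    ; es-ends   = All-treeEdges _ λ w∈ w≢v → let p∈ = parent∈S w∈ (πᴳ w∈ w≢v) in
        ord-elim (λ a b → a ∈ ws × b ∈ ws) (p∈ , w∈) (w∈ , p∈)
    }

  tree⊆TvG : SubgraphOf (TvG G v) tree
  tree⊆TvG = All-treeEdges _ λ w∈ w≢v →
    let e , e′ = parent-edge∈TvG v (πᴳ w∈ w≢v) in ord-elim (TvG G v) e e′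

  ToRoot : ℕ → Set
  ToRoot k = ∀ {w} → w ∈ ws → Walk (GE G) U v w k → ∃ (Walk (SubEdge tree) (_∈ ws) w v)

  to-root : ∀ k → ToRoot k
  to-root = <-rec ToRoot climb
    where
    climb : ∀ k → (∀ {j} → j < k → ToRoot j) → ToRoot k
    climb k rec {w} w∈ ω with w ≟ v
    ... | yes refl = 0 , here w∈
    ... | no w≢v with rec (deeper (πᴳ w∈ w≢v) ω) (parent∈S w∈ (πᴳ w∈ w≢v)) (walk (πᴳ w∈ w≢v))
    ...   | _ , p⋯v = _ , step w∈ (Sum.swap (ord∈⇒SubEdge tree (∈-treeEdges⁺ _ w∈ w≢v))) p⋯v

  tree-connected : Connected (SubEdge tree) (_∈ vs tree)
  tree-connected a b a∈ b∈ with to-root _ a∈ (proj₂ (conn v a tt tt)) | to-root _ b∈ (proj₂ (conn v b tt tt))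
  ... | _ , a⋯v | _ , b⋯v = _ , a⋯v ++ʷ reverse Sum.swap b⋯v

  -- Parent edges in G and in S alike number one per vertex of S other than v; the latter are edges of S.
  tree-size : ParentMap (SubEdge S) (_∈ ws) v ws → m tree ≤ m S
  tree-size πS = begin
    m tree
      ≡⟨ treeEdges-length (parent πG) (parent πS) ⟩
    length (treeEdges (parent πS))
      ≤⟨ Unique-⊆⇒length≤ (treeEdges-unique (vs-unique S) πS) (All.lookup edges∈S) ⟩
    m S ∎
    where
    open ≤-Reasoning
    edges∈S = All-treeEdges (parent πS) λ w∈ w≢v → SubEdge⇒ord∈ S (edge (isParent πS w∈ w≢v))

cover-in-TvG : (G : Graph n) → ConnectedGraph G → BlockGraph G → ∀ v {X} S → v ∈ X → ConnCover (GE G) X S →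
               ¬ ¬ ∃ λ S′ → ConnCover (TvG G v) X S′ × m S′ ≤ m S
cover-in-TvG G conn bg v {X} S v∈X cS@(_ , connS , X⊆S) = do
  πG ← ¬¬-parentMap λ {w} _ → conn v w tt tt
  πS ← ¬¬-parentMap λ {w} w∈ → connS v w (All.lookup X⊆S v∈X) w∈
  let open BreadthFirstTree G conn bg v {X} {S} cS v∈X πG
  pure (tree , (tree⊆TvG , tree-connected , X⊆S) , tree-size πS)

theorem2p2 : ∀ {n : ℕ} (G : Graph n) → ConnectedGraph G → BlockGraph G →
    (v : Fin n) (k : ℕ) → 1 ≤ k → k ≤ n → (T₁ : Sub n) →
    SteinerEccTree (TvG G v) k v T₁ → SteinerEccTree (GE G) k v T₁
theorem2p2 G conn bg v k _ _ T₁ ((X , |X|≡k , uX , v∈X , (cover , minimal)) , ecc) =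
  (X , |X|≡k , uX , v∈X , (TvG⇒G T₁ cover , minimalᴳ)) , eccᴳ
  where
  TvG⇒G : ∀ {Y} S → ConnCover (TvG G v) Y S → ConnCover (GE G) Y S
  TvG⇒G {Y} S = ConnCover-mono {X = Y} {S} proj₁

  minimalᴳ : ∀ S → ConnCover (GE G) X S → m T₁ ≤ m S
  minimalᴳ S cS = decidable-stable (m T₁ ≤? m S) do
    (S′ , cS′ , S′≤S) ← cover-in-TvG G conn bg v S v∈X cS
    pure (≤-trans (minimal S′ cS′) S′≤S)

  eccᴳ : ∀ X′ S → length X′ ≡ k → Unique X′ → v ∈ X′ → SteinerTree (GE G) X′ S → m S ≤ m T₁
  eccᴳ X′ S |X′|≡k uX′ v∈X′ (cS , minimalS) = decidable-stable (m S ≤? m T₁) do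
    (S′ , cS′ , _) ← cover-in-TvG G conn bg v S v∈X′ cS
    (M , steinerM) ← ¬¬-steiner {X = X′} {S′} cS′
    pure (≤-trans (minimalS M (TvG⇒G M (proj₁ steinerM))) (ecc X′ M |X′|≡k uX′ v∈X′ steinerM))
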